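{- In strict semantics, there is no finite set $\Phi\subseteq\mathcal{B}(\mathrm{PL})$ such that for every team $T$: $T\models\Phi$ if and only if $T\models\textsc{ne}\sqcap\sim(\textsc{ne}\otimes\textsc{ne})$.
   Context: Fix a countably infinite set $\mathrm{PS}$ of propositional variables; $\mathrm{PL}$ formulas are built from $\mathrm{PS}$ with $\neg,\to$ ($\top:=\alpha\to\alpha$, $\bot:=\neg\top$). $\mathcal{B}(\mathrm{PL})$ is the closure of $\mathrm{PL}$ under $\sim$ and $\rightarrowtail$. A team $T$ is a set of assignments $s:\mathrm{PS}\to\{0,1\}$; for $\alpha\in\mathrm{PL}$, $T\models\alpha$ iff every $s\in T$ satisfies $\alpha$ classically; $T\models\sim\varphi$ iff $T\not\models\varphi$; $T\models\varphi\rightarrowtail\psi$ iff $T\not\models\varphi$ or $T\models\psi$; $\varphi\sqcap\psi:=\sim(\varphi\rightarrowtail\sim\psi)$; $\textsc{ne}:=\sim\bot$ (true exactly in nonempty teams). In strict semantics, $T\models\varphi\otimes\psi$ iff there are $S,U$ with $S\cup U=T$, $S\cap U=\emptyset$, $S\models\varphi$ and $U\models\psi$. $T\models\Phi$ means $T$ satisfies every member of $\Phi$. -}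

module Defs where

open import Data.Nat using (ℕ)
open import Data.Bool using (Bool; true; false; not; _∨_)
open import Data.Empty using (⊥)
open import Data.Sum using (_⊎_)
open import Data.Product using (Σ; _×_; ∃-syntax)
open import Data.List using (List)
open import Data.List.Relation.Unary.All using (All)
open import Relation.Binary.PropositionalEquality using (_≡_)
open import Relation.Nullary using (¬_)
open import Level using (Level)

PS : Set
PS = ℕ

data PL : Set where
  var : PS → PL
  neg : PL → PL
  imp : PL → PL → PL

⊤PL : PL
⊤PL = imp (var 0) (var 0)

⊥PL : PL
⊥PL = neg ⊤PL

Assignment : Set
Assignment = PS → Bool

eval : Assignment → PL → Bool
eval s (var p)   = s p
eval s (neg α)   = not (eval s α)
eval s (imp α β) = not (eval s α) ∨ eval s β

Team : Set₁
Team = Assignment → Set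

data Form : Set where
  atom : PL → Form
  ∼_   : Form → Form
  _↣_  : Form → Form → Form
  _⊗_  : Form → Form → Form

data InB : Form → Set where
  atom : (α : PL) → InB (atom α)
  ∼_   : {φ : Form} → InB φ → InB (∼ φ)
  _↣_  : {φ ψ : Form} → InB φ → InB ψ → InB (φ ↣ ψ)

_⊓_ : Form → Form → Form
φ ⊓ ψ = ∼ (φ ↣ (∼ ψ))

NE : Form
NE = ∼ (atom ⊥PL)

_⊨_ : Team → Form → Set₁
T ⊨ atom α  = Level.Lift _ (∀ s → T s → eval s α ≡ true)
T ⊨ (∼ φ)   = ¬ (T ⊨ φ)
T ⊨ (φ ↣ ψ) = ¬ (T ⊨ φ) ⊎ (T ⊨ ψ)
T ⊨ (φ ⊗ ψ) = ∃[ S ] ∃[ U ]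
                 ((∀ s → T s → S s ⊎ U s)
                 × (∀ s → S s ⊎ U s → T s)
                 × (∀ s → S s → U s → ⊥)
                 × (S ⊨ φ) × (U ⊨ ψ))

_⊨*_ : Team → List Form → Set₁
T ⊨* Φ = All (T ⊨_) Φ

module Submission where

-- The property  NE ⊓ ∼(NE ⊗ NE)  holds exactly in the teams with precisely one
-- element.  It is not definable by a finite set Φ of B(PL)-formulas because
-- such Φ only mentions variables below some bound N, and B(PL) cannot tell a
-- team {s} from the team {s, t} when s and t agree on every variable below N:
--
--   * a PL atom is true in {s} iff it is true in {s, t}, since s and t give it
--     the same truth value (eval-agree, single≈pair);
--   * ∼ and ↣ are Boolean in the satisfaction of their arguments, so every
--     B(PL)-formula with variables below N inherits this invariance
--     (InB-invariant, InB-invariant*);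
--   * yet {s} satisfies the property (single-satisfies-target), whereas any
--     team {s, t} with s ≢ t splits into two nonempty parts (pair-splits).
--
-- Taking s the all-false assignment and t the one that is true exactly from
-- N on yields the contradiction in theorem27.

open import Defs
open import Data.Bool using (true; false; not; _∨_; T)
open import Data.Empty using (⊥; ⊥-elim)
open import Data.List using (List; []; _∷_)
open import Data.List.Relation.Unary.All using (All; []; _∷_)
open import Data.Nat using (ℕ; suc; _+_; _≤_; _<_; _≤ᵇ_)
open import Data.Nat.Properties using (m+n≤o⇒m≤o; m+n≤o⇒n≤o; ≤-refl; ≤ᵇ⇒≤; ≤⇒≤ᵇ; <⇒≱)
open import Data.Product using (_×_; ∃-syntax; _,_; proj₁; proj₂)
open import Data.Sum using (_⊎_; inj₁; inj₂)
open import Function.Bundles using (_⇔_; mk⇔; Equivalence)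
open import Level using (lift)
open import Relation.Binary.PropositionalEquality using (_≡_; _≢_; refl; sym; trans; cong; cong₂; subst)
open import Relation.Nullary using (¬_)

open Equivalence using (to; from)

varBound : PL → ℕ
varBound (var p)   = suc p
varBound (neg α)   = varBound α
varBound (imp α β) = varBound α + varBound β

formBound : Form → ℕ
formBound (atom α) = varBound α
formBound (∼ φ)    = formBound φ
formBound (φ ↣ ψ)  = formBound φ + formBound ψ
formBound (φ ⊗ ψ)  = formBound φ + formBound ψ

listBound : List Form → ℕ
listBound []      = 0
listBound (φ ∷ Φ) = formBound φ + listBound Φ

AgreeBelow : ℕ → Assignment → Assignment → Set
AgreeBelow N s t = ∀ p → p < N → s p ≡ t p

eval-agree : ∀ {N s t} α → varBound α ≤ N → AgreeBelow N s t → eval s α ≡ eval t α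
eval-agree (var p)   p<N agree = agree p p<N
eval-agree (neg α)   b≤N agree = cong not (eval-agree α b≤N agree)
eval-agree (imp α β) b≤N agree =
  cong₂ _∨_ (cong not (eval-agree α (m+n≤o⇒m≤o (varBound α) b≤N) agree))
            (eval-agree β (m+n≤o⇒n≤o (varBound α) b≤N) agree)

AtomEquivalent : ℕ → Team → Team → Set₁
AtomEquivalent N T U = ∀ α → varBound α ≤ N → (T ⊨ atom α) ⇔ (U ⊨ atom α)

-- B(PL)-formulas cannot separate atom-equivalent teams: satisfaction of ∼ and
-- ↣ is a Boolean function of the satisfaction of their arguments.
InB-invariant : ∀ {N T U} → AtomEquivalent N T U →
                ∀ {φ} → InB φ → formBound φ ≤ N → (T ⊨ φ) ⇔ (U ⊨ φ)
InB-invariant equiv (atom α) b≤N = equiv α b≤N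
InB-invariant equiv (∼ i) b≤N =
  let e = InB-invariant equiv i b≤N
  in mk⇔ (λ ¬φ φ → ¬φ (from e φ)) (λ ¬φ φ → ¬φ (to e φ))
InB-invariant equiv {φ ↣ ψ} (i ↣ j) b≤N =
  let e₁ = InB-invariant equiv i (m+n≤o⇒m≤o (formBound φ) b≤N)
      e₂ = InB-invariant equiv j (m+n≤o⇒n≤o (formBound φ) b≤N)
  in mk⇔ (λ { (inj₁ ¬φ) → inj₁ (λ φ → ¬φ (from e₁ φ)) ; (inj₂ ψ) → inj₂ (to e₂ ψ) })
         (λ { (inj₁ ¬φ) → inj₁ (λ φ → ¬φ (to e₁ φ))   ; (inj₂ ψ) → inj₂ (from e₂ ψ) })

InB-invariant* : ∀ {N T U} → AtomEquivalent N T U →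
                 ∀ {Φ} → All InB Φ → listBound Φ ≤ N → T ⊨* Φ → U ⊨* Φ
InB-invariant* equiv []       b≤N []       = []
InB-invariant* equiv {φ ∷ Φ} (i ∷ is) b≤N (x ∷ xs) =
  to (InB-invariant equiv i (m+n≤o⇒m≤o (formBound φ) b≤N)) x
  ∷ InB-invariant* equiv is (m+n≤o⇒n≤o (formBound φ) b≤N) xs

single : Assignment → Team
single s u = u ≡ s

pair : Assignment → Assignment → Team
pair s t u = u ≡ s ⊎ u ≡ t

single≈pair : ∀ {N s t} → AgreeBelow N s t → AtomEquivalent N (single s) (pair s t)
single≈pair {s = s} {t} agree α b≤N = mk⇔ forth back
  where
  forth : single s ⊨ atom α → pair s t ⊨ atom α
  forth (lift f) = lift λ { _ (inj₁ refl) → f s refl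
                          ; _ (inj₂ refl) → trans (sym (eval-agree α b≤N agree)) (f s refl) }
  back : pair s t ⊨ atom α → single s ⊨ atom α
  back (lift f) = lift λ { _ refl → f s (inj₁ refl) }

⊥PL-false : ∀ s → eval s ⊥PL ≡ false
⊥PL-false s with s 0
... | true  = refl
... | false = refl

member⇒NE : ∀ {T s} → T s → T ⊨ NE
member⇒NE {s = s} Ts (lift f) with trans (sym (⊥PL-false s)) (f s Ts)
... | ()

empty⇒atom : ∀ {T} α → (∀ s → T s → ⊥) → T ⊨ atom α
empty⇒atom α empty = lift λ s Ts → ⊥-elim (empty s Ts)

NE-incompatible : ∀ {S U} → S ⊨ NE → U ⊨ NE → ¬ (∀ s u → S s → U u → ⊥)
NE-incompatible neS neU clash =
  neS (empty⇒atom ⊥PL λ s Ss → neU (empty⇒atom ⊥PL λ u Uu → clash s u Ss Uu))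

single-unsplittable : ∀ s → ¬ (single s ⊨ (NE ⊗ NE))
single-unsplittable s (S , U , _ , sub , disj , neS , neU) =
  NE-incompatible neS neU clash
  where
  clash : ∀ x y → S x → U y → ⊥
  clash x y Sx Uy with sub x (inj₁ Sx) | sub y (inj₂ Uy)
  ... | refl | refl = disj x Sx Uy

Target : Form
Target = NE ⊓ (∼ (NE ⊗ NE))

single-satisfies-target : ∀ s → single s ⊨ Target
single-satisfies-target s (inj₁ ¬NE)   = ¬NE (member⇒NE refl)
single-satisfies-target s (inj₂ ¬¬split) = ¬¬split (single-unsplittable s)

⊓∼-elim : ∀ {T} φ ψ → T ⊨ (φ ⊓ (∼ ψ)) → ¬ (T ⊨ ψ)
⊓∼-elim _ _ target ψ = target (inj₂ (λ ¬ψ → ¬ψ ψ))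

pair-splits : ∀ {s t} → s ≢ t → pair s t ⊨ (NE ⊗ NE)
pair-splits {s} {t} s≢t =
  single s , single t , (λ _ x → x) , (λ _ x → x)
  , (λ { _ refl u≡t → s≢t u≡t }) , member⇒NE refl , member⇒NE refl

trueFrom : ℕ → Assignment
trueFrom N p = N ≤ᵇ p

allFalse≈trueFrom : ∀ N → AgreeBelow N (λ _ → false) (trueFrom N)
allFalse≈trueFrom N p p<N with N ≤ᵇ p in eq
... | false = refl
... | true  = ⊥-elim (<⇒≱ p<N (≤ᵇ⇒≤ N p (subst T (sym eq) _)))

allFalse≢trueFrom : ∀ N → (λ _ → false) ≢ trueFrom N
allFalse≢trueFrom N eq = subst T (sym (cong (λ f → f N) eq)) (≤⇒≤ᵇ (≤-refl {N}))

theorem27 : ¬ (∃[ Φ ] (All InB Φ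
    × (∀ (T : Team) → ((T ⊨* Φ → T ⊨ (NE ⊓ (∼ (NE ⊗ NE))))
    × (T ⊨ (NE ⊓ (∼ (NE ⊗ NE))) → T ⊨* Φ)))))
theorem27 (Φ , inB , defines) =
  ⊓∼-elim NE (NE ⊗ NE) pairTarget (pair-splits {s} {t} (allFalse≢trueFrom N))
  where
  N : ℕ
  N = listBound Φ
  s t : Assignment
  s = λ _ → false
  t = trueFrom N
  singleΦ : single s ⊨* Φ
  singleΦ = proj₂ (defines (single s)) (single-satisfies-target s)
  pairΦ : pair s t ⊨* Φ
  pairΦ = InB-invariant* (single≈pair (allFalse≈trueFrom N)) inB ≤-refl singleΦ
  pairTarget : pair s t ⊨ Target
  pairTarget = proj₁ (defines (pair s t)) pairΦ
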